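{- Let $P_n$ be the path graph on $n$ vertices and $k$ a positive integer. For any integer $0\le j\le\lfloor n/2\rfloor$, $$\chi_j^k(P_n)=\begin{cases} n-1-2j & \text{if } k=1,\\ 0 & \text{if } k\ge 2.\end{cases}$$
   Context: For a positive integer $k$, a nonnegative integer $j$ and a simple graph $G=(V,E)$, a set $E'\subseteq E$ is a $k$-chromatic number $j$-mixed edge removal set if there exists $V'\subseteq V$ with $|V'|=j$ such that $\chi(G-V'-E')\le k$, where $\chi$ is the chromatic number and $G-V'-E'$ is obtained from $G$ by deleting the vertices in $V'$ (with their incident edges) and the remaining edges of $E'$. The parameter $\chi_j^k(G)$ is the minimum of $|E'|$ over all $k$-chromatic number $j$-mixed edge removal sets $E'$. -}

module Defs where

open import Data.Nat using (ℕ; suc; _<_)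
open import Data.Fin using (Fin; toℕ)
open import Data.Fin.Subset using (Subset; ∣_∣; _∉_)
open import Data.Product using (Σ; _×_; _,_)
open import Data.Sum using (_⊎_)
open import Data.List using (List; length)
open import Data.List.Relation.Unary.All using (All)
open import Data.List.Relation.Unary.Unique.Propositional using (Unique)
open import Data.List.Membership.Propositional using (_∈_)
open import Relation.Binary.PropositionalEquality using (_≡_; _≢_)
open import Relation.Nullary using (¬_)

record Graph (n : ℕ) : Set₁ where
  field
    Adj        : Fin n → Fin n → Set
    Adj-sym    : ∀ {u v} → Adj u v → Adj v u
    Adj-irrefl : ∀ {u} → ¬ Adj u u
open Graph public

-- An edge {u,v} of G is represented canonically by the ordered pair (u , v) with u < v.
IsEdge : ∀ {n} → Graph n → Fin n × Fin n → Set
IsEdge G (u , v) = (toℕ u < toℕ v) × Adj G u v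

EdgeSet : ∀ {n} → Graph n → Set
EdgeSet {n} G = Σ (List (Fin n × Fin n)) λ es → All (IsEdge G) es × Unique es

card : ∀ {n} {G : Graph n} → EdgeSet G → ℕ
card (es , _) = length es

AdjRemoved : ∀ {n} (G : Graph n) → Subset n → EdgeSet G → Fin n → Fin n → Set
AdjRemoved G V' (es , _) u v =
  u ∉ V' × v ∉ V' × Adj G u v × ¬ ((u , v) ∈ es) × ¬ ((v , u) ∈ es)

ChromaticAtMost : ∀ {n} (G : Graph n) → Subset n → EdgeSet G → ℕ → Set
ChromaticAtMost {n} G V' E' k =
  Σ ((v : Fin n) → v ∉ V' → Fin k) λ c →
    ∀ u v (pu : u ∉ V') (pv : v ∉ V') → AdjRemoved G V' E' u v → c u pu ≢ c v pv

IsMixedRemovalSet : ∀ {n} (G : Graph n) → ℕ → ℕ → EdgeSet G → Set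
IsMixedRemovalSet {n} G k j E' =
  Σ (Subset n) λ V' → (∣ V' ∣ ≡ j) × ChromaticAtMost G V' E' k

ChiMixed≡ : ∀ {n} (G : Graph n) → ℕ → ℕ → ℕ → Set
ChiMixed≡ G k j m =
  Σ (EdgeSet G) (λ E' → IsMixedRemovalSet G k j E' × card {G = G} E' ≡ m)
  × (∀ (E' : EdgeSet G) → IsMixedRemovalSet G k j E' → m Data.Nat.≤ card {G = G} E')

Path : (n : ℕ) → Graph n
Path n = record
  { Adj = λ u v → (toℕ v ≡ suc (toℕ u)) ⊎ (toℕ u ≡ suc (toℕ v))
  ; Adj-sym = sym'
  ; Adj-irrefl = irr
  }
  where
  open import Data.Sum using (inj₁; inj₂)
  open import Data.Nat.Properties using (1+n≢n)
  open import Relation.Binary.PropositionalEquality using (sym)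
  sym' : ∀ {u v : Fin n} → (toℕ v ≡ suc (toℕ u)) ⊎ (toℕ u ≡ suc (toℕ v))
                          → (toℕ u ≡ suc (toℕ v)) ⊎ (toℕ v ≡ suc (toℕ u))
  sym' (inj₁ p) = inj₂ p
  sym' (inj₂ p) = inj₁ p
  irr : ∀ {u : Fin n} → ¬ ((toℕ u ≡ suc (toℕ u)) ⊎ (toℕ u ≡ suc (toℕ u)))
  irr {u} (inj₁ p) = 1+n≢n (sym p)
  irr {u} (inj₂ p) = 1+n≢n (sym p)

{-# OPTIONS --safe #-}
module Submission where

-- Deleting V from P_n leaves exactly the edges {i, i+1} with both ends outside V. Every vertex
-- lies on at most two edges, so at least n − 1 − 2|V| edges survive, and with a single colour
-- every survivor must be removed; the set {1, 3, …, 2j − 1} meets exactly 2j edges, so this is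
-- sharp. With two or more colours, colouring by parity is already proper, so nothing is removed.

open import Defs
open import Data.Nat using (ℕ; _+_; _≤_; _*_; _∸_; _/_; zero; suc; z≤n; s≤s; s≤s⁻¹)
open import Data.Nat.Properties
  using (suc-injective; <⇒≤; ≤-reflexive; <-asym; +-suc; *-suc; ∸-+-assoc; ∸-monoˡ-≤; m≤n+o⇒m∸n≤o; module ≤-Reasoning)
open import Data.Nat.DivMod using (m/n≡1+[m∸n]/n)
open import Data.Fin using (Fin; toℕ; zero; suc)
open import Data.Fin.Properties using () renaming (_≟_ to _≟ᶠ_)
open import Data.Fin.Subset using (Subset; Side; ∣_∣; _∉_; inside; outside; ⊥)
open import Data.Fin.Subset.Properties using (drop-there; drop-not-there; ∣⊥∣≡0)
import Data.Vec.Base as Vec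
open import Data.Vec.Base using ([]; _∷_)
open import Data.Product using (_×_; _,_; proj₁)
open import Data.Product.Properties using (≡-dec)
open import Data.Sum using (inj₁; inj₂)
open import Data.List using (List; []; _∷_; _++_; map; length)
open import Data.List.Properties using (length-map; length-removeAt′)
open import Data.List.Relation.Unary.All using (All; []; _∷_)
import Data.List.Relation.Unary.All as All
import Data.List.Relation.Unary.All.Properties as All
open import Data.List.Relation.Unary.Any using (here; there; index; _─_; any?)
open import Data.List.Relation.Unary.AllPairs using ([]; _∷_)
open import Data.List.Relation.Unary.Unique.Propositional using (Unique)
import Data.List.Relation.Unary.Unique.Propositional.Properties as Unique
open import Data.List.Relation.Binary.Disjoint.Propositional using (Disjoint)
open import Data.List.Relation.Binary.Subset.Propositional using (_⊆_)
open import Data.List.Membership.Propositional using (_∈_)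
open import Data.List.Membership.Propositional.Properties using (∈-map⁺; ∈-map⁻; ∈-++⁺ʳ)
open import Function using (_∘_)
open import Relation.Nullary using (¬_; yes; no; contradiction)
open import Relation.Binary.PropositionalEquality
  using (_≡_; _≢_; refl; sym; trans; cong; subst; module ≡-Reasoning)

module _ {a} {A : Set a} where

  ∈-─⁺ : ∀ {x y : A} {ys} (x∈ys : x ∈ ys) → y ∈ ys → y ≢ x → y ∈ (ys ─ x∈ys)
  ∈-─⁺ (here refl)  (here refl)  y≢x = contradiction refl y≢x
  ∈-─⁺ (here refl)  (there y∈ys) _   = y∈ys
  ∈-─⁺ (there _)    (here refl)  _   = here refl
  ∈-─⁺ (there x∈ys) (there y∈ys) y≢x = there (∈-─⁺ x∈ys y∈ys y≢x)

  Unique⇒length-mono-⊆ : {xs ys : List A} → Unique xs → xs ⊆ ys → length xs ≤ length ys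
  Unique⇒length-mono-⊆ {[]}          _            _     = z≤n
  Unique⇒length-mono-⊆ {x ∷ xs} {ys} (x∉xs ∷ xs!) xs⊆ys = begin
    suc (length xs)          ≤⟨ s≤s (Unique⇒length-mono-⊆ xs! xs⊆ys─x) ⟩
    suc (length (ys ─ x∈ys)) ≡⟨ sym (length-removeAt′ ys (index x∈ys)) ⟩
    length ys                ∎
    where
    open ≤-Reasoning
    x∈ys = xs⊆ys (here refl)
    xs⊆ys─x : xs ⊆ (ys ─ x∈ys)
    xs⊆ys─x y∈xs = ∈-─⁺ x∈ys (xs⊆ys (there y∈xs)) λ { refl → All.lookup x∉xs y∈xs refl }

sucEdge : ∀ {n} → Fin n × Fin n → Fin (suc n) × Fin (suc n)
sucEdge (u , v) = suc u , suc v

sucEdge-injective : ∀ {n} {e f : Fin n × Fin n} → sucEdge e ≡ sucEdge f → e ≡ f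
sucEdge-injective {e = _ , _} {f = _ , _} refl = refl

SurvivingEdge : ∀ {n} → Subset n → Fin n × Fin n → Set
SurvivingEdge V (u , v) = u ∉ V × v ∉ V × toℕ v ≡ suc (toℕ u)

headEdge : ∀ {n} → Side → Side → List (Fin (suc (suc n)) × Fin (suc (suc n)))
headEdge outside outside = (zero , suc zero) ∷ []
headEdge _       _       = []

survivingEdges : ∀ {n} → Subset n → List (Fin n × Fin n)
survivingEdges []          = []
survivingEdges (_ ∷ [])    = []
survivingEdges (x ∷ y ∷ p) = headEdge x y ++ map sucEdge (survivingEdges (y ∷ p))

survivingEdges-inside∷ : ∀ {n} (p : Subset n) → survivingEdges (inside ∷ p) ≡ map sucEdge (survivingEdges p)
survivingEdges-inside∷ []      = refl
survivingEdges-inside∷ (_ ∷ _) = refl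

survivingEdges-sound : ∀ {n} (V : Subset n) → All (SurvivingEdge V) (survivingEdges V)
survivingEdges-sound []          = []
survivingEdges-sound (_ ∷ [])    = []
survivingEdges-sound (x ∷ y ∷ p) =
  All.++⁺ (headEdge-sound x y) (All.map⁺ (All.map sucEdge-survives (survivingEdges-sound (y ∷ p))))
  where
  headEdge-sound : ∀ x y → All (SurvivingEdge (x ∷ y ∷ p)) (headEdge x y)
  headEdge-sound outside outside = ((λ ()) , (λ { (Vec.there ()) }) , refl) ∷ []
  headEdge-sound outside inside  = []
  headEdge-sound inside  _       = []
  sucEdge-survives : ∀ {e} → SurvivingEdge (y ∷ p) e → SurvivingEdge (x ∷ y ∷ p) (sucEdge e)
  sucEdge-survives {_ , _} (u∉V , v∉V , v≡1+u) = u∉V ∘ drop-there , v∉V ∘ drop-there , cong suc v≡1+u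

survivingEdges-complete : ∀ {n} (V : Subset n) {u v} →
  u ∉ V → v ∉ V → toℕ v ≡ suc (toℕ u) → (u , v) ∈ survivingEdges V
survivingEdges-complete (inside ∷ _)            {zero}            u∉V _   _ = contradiction Vec.here u∉V
survivingEdges-complete (outside ∷ inside ∷ _)  {zero} {suc zero} _   v∉V _ = contradiction (Vec.there Vec.here) v∉V
survivingEdges-complete (outside ∷ outside ∷ _) {zero} {suc zero} _   _   _ = here refl
survivingEdges-complete (x ∷ y ∷ p) {suc u} {suc v} u∉V v∉V v≡1+u =
  ∈-++⁺ʳ (headEdge x y) (∈-map⁺ sucEdge
    (survivingEdges-complete (y ∷ p) (drop-not-there u∉V) (drop-not-there v∉V) (suc-injective v≡1+u)))

survivingEdges-unique : ∀ {n} (V : Subset n) → Unique (survivingEdges V)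
survivingEdges-unique []          = []
survivingEdges-unique (_ ∷ [])    = []
survivingEdges-unique (x ∷ y ∷ p) =
  Unique.++⁺ (headEdge-unique x y) (Unique.map⁺ sucEdge-injective (survivingEdges-unique (y ∷ p)))
             (headEdge-disjoint x y)
  where
  headEdge-unique : ∀ x y → Unique (headEdge x y)
  headEdge-unique outside outside = [] ∷ []
  headEdge-unique outside inside  = []
  headEdge-unique inside  _       = []
  headEdge-disjoint : ∀ x y → Disjoint (headEdge x y) (map sucEdge (survivingEdges (y ∷ p)))
  headEdge-disjoint outside outside (here refl , e∈) with ∈-map⁻ sucEdge e∈
  ... | (_ , _) , _ , ()

≤-step-2*suc : ∀ {m l} s → m ≤ suc (2 * s + l) → 2 + m ≤ suc (2 * suc s + l)
≤-step-2*suc {m} {l} s m≤ = begin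
  2 + m                  ≤⟨ s≤s (s≤s m≤) ⟩
  3 + (2 * s + l)        ≡⟨ cong suc (cong (_+ l) (sym (*-suc 2 s))) ⟩
  suc (2 * suc s + l)    ∎
  where open ≤-Reasoning

-- Every vertex of V lies on at most two edges of P_n; a leading one on at most one.
length-survivingEdges-bound : ∀ {n} (V : Subset n) → n ≤ suc (2 * ∣ V ∣ + length (survivingEdges V))
length-survivingEdges-bound []       = z≤n
length-survivingEdges-bound (_ ∷ []) = s≤s z≤n
length-survivingEdges-bound (inside ∷ y ∷ p) with length-survivingEdges-bound (y ∷ p)
... | bound rewrite length-map sucEdge (survivingEdges (y ∷ p)) = ≤-step-2*suc ∣ y ∷ p ∣ (<⇒≤ bound)
length-survivingEdges-bound (outside ∷ inside ∷ p) with length-survivingEdges-bound p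
... | bound rewrite survivingEdges-inside∷ p
                  | length-map sucEdge (map sucEdge (survivingEdges p))
                  | length-map sucEdge (survivingEdges p) = ≤-step-2*suc ∣ p ∣ bound
length-survivingEdges-bound {suc (suc n)} (outside ∷ outside ∷ p)
  with length-survivingEdges-bound (outside ∷ p)
... | bound rewrite length-map sucEdge (survivingEdges (outside ∷ p)) =
  subst (λ t → 2 + n ≤ suc t) (sym (+-suc (2 * ∣ p ∣) _)) (s≤s bound)

length-survivingEdges-≥ : ∀ {n} (V : Subset n) → n ∸ 1 ∸ 2 * ∣ V ∣ ≤ length (survivingEdges V)
length-survivingEdges-≥ {n} V =
  m≤n+o⇒m∸n≤o (n ∸ 1) (2 * ∣ V ∣) (∸-monoˡ-≤ 1 (length-survivingEdges-bound V))

length-survivingEdges-⊥ : ∀ n → length (survivingEdges (⊥ {n = n})) ≡ n ∸ 1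
length-survivingEdges-⊥ zero          = refl
length-survivingEdges-⊥ (suc zero)    = refl
length-survivingEdges-⊥ (suc (suc n)) =
  cong suc (trans (length-map sucEdge (survivingEdges (⊥ {n = suc n}))) (length-survivingEdges-⊥ (suc n)))

suc≤half⇒≤half : ∀ {j} n → suc j ≤ suc (suc n) / 2 → j ≤ n / 2
suc≤half⇒≤half {j} n le = s≤s⁻¹ (subst (suc j ≤_) (m/n≡1+[m∸n]/n {suc (suc n)} (s≤s (s≤s z≤n))) le)

alternating : ℕ → (n : ℕ) → Subset n
alternating (suc j) (suc (suc n)) = outside ∷ inside ∷ alternating j n
alternating _       _             = ⊥

∣alternating∣ : ∀ j n → j ≤ n / 2 → ∣ alternating j n ∣ ≡ j
∣alternating∣ zero    n             _  = ∣⊥∣≡0 n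
∣alternating∣ (suc j) (suc (suc n)) le = cong suc (∣alternating∣ j n (suc≤half⇒≤half n le))

length-survivingEdges-alternating : ∀ j n → j ≤ n / 2 →
  length (survivingEdges (alternating j n)) ≡ n ∸ 1 ∸ 2 * j
length-survivingEdges-alternating zero    n             _  = length-survivingEdges-⊥ n
length-survivingEdges-alternating (suc j) (suc (suc n)) le = begin
  length (map sucEdge (survivingEdges (inside ∷ A)))     ≡⟨ cong (length ∘ map sucEdge) (survivingEdges-inside∷ A) ⟩
  length (map sucEdge (map sucEdge (survivingEdges A)))  ≡⟨ length-map sucEdge (map sucEdge (survivingEdges A)) ⟩
  length (map sucEdge (survivingEdges A))                ≡⟨ length-map sucEdge (survivingEdges A) ⟩
  length (survivingEdges A)                              ≡⟨ length-survivingEdges-alternating j n (suc≤half⇒≤half n le) ⟩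
  n ∸ 1 ∸ 2 * j                                          ≡⟨ ∸-+-assoc n 1 (2 * j) ⟩
  n ∸ suc (2 * j)                                        ≡⟨ cong (suc n ∸_) (sym (*-suc 2 j)) ⟩
  suc n ∸ 2 * suc j                                      ∎
  where
  open ≡-Reasoning
  A = alternating j n

χ≤1⇒edgeless : ∀ {n} {G : Graph n} {V E u v} → ChromaticAtMost G V E 1 → ¬ AdjRemoved G V E u v
χ≤1⇒edgeless {u = u} {v} (c , proper) adj@(u∉V , v∉V , _) =
  proper u v u∉V v∉V adj (Fin1-allEqual (c u u∉V) (c v v∉V))
  where
  Fin1-allEqual : (i j : Fin 1) → i ≡ j
  Fin1-allEqual zero zero = refl

survivingEdgeSet : ∀ {n} → Subset n → EdgeSet (Path n)
survivingEdgeSet V = survivingEdges V , All.map isEdge (survivingEdges-sound V) , survivingEdges-unique V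
  where
  isEdge : ∀ {e} → SurvivingEdge V e → IsEdge (Path _) e
  isEdge {_ , _} (_ , _ , v≡1+u) = ≤-reflexive (sym v≡1+u) , inj₁ v≡1+u

survivingEdgeSet-χ≤1 : ∀ {n} (V : Subset n) → ChromaticAtMost (Path n) V (survivingEdgeSet V) 1
survivingEdgeSet-χ≤1 V = (λ _ _ → zero) , λ where
  u v u∉V v∉V (_ , _ , inj₁ v≡1+u , uv∉E , _) _ → uv∉E (survivingEdges-complete V u∉V v∉V v≡1+u)
  u v u∉V v∉V (_ , _ , inj₂ u≡1+v , _ , vu∉E) _ → vu∉E (survivingEdges-complete V v∉V u∉V u≡1+v)

χ≤1⇒survivingEdges⊆ : ∀ {n} {V : Subset n} (E : EdgeSet (Path n)) →
  ChromaticAtMost (Path n) V E 1 → survivingEdges V ⊆ proj₁ E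
χ≤1⇒survivingEdges⊆ {V = V} E@(es , canonical , _) χ≤1 {u , v} e∈ with All.lookup (survivingEdges-sound V) e∈
... | u∉V , v∉V , v≡1+u with any? (≡-dec _≟ᶠ_ _≟ᶠ_ (u , v)) es
...   | yes uv∈E = uv∈E
...   | no  uv∉E = contradiction (u∉V , v∉V , inj₁ v≡1+u , uv∉E , vu∉E) (χ≤1⇒edgeless {G = Path _} {E = E} χ≤1)
  where
  vu∉E : ¬ (v , u) ∈ es
  vu∉E vu∈E = <-asym (proj₁ (All.lookup canonical vu∈E)) (≤-reflexive (sym v≡1+u))

parity : ∀ {k} → ℕ → Fin (suc (suc k))
parity zero          = zero
parity (suc zero)    = suc zero
parity (suc (suc m)) = parity m

parity-suc : ∀ {k} m → parity {k} m ≢ parity (suc m)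
parity-suc zero          ()
parity-suc (suc zero)    ()
parity-suc (suc (suc m)) = parity-suc m

Path-χ≤2+k : ∀ {n k} (V : Subset n) (E : EdgeSet (Path n)) → ChromaticAtMost (Path n) V E (suc (suc k))
Path-χ≤2+k _ _ = (λ v _ → parity (toℕ v)) , λ where
  u v _ _ (_ , _ , inj₁ v≡1+u , _) c≡ → parity-suc (toℕ u) (trans c≡ (cong parity v≡1+u))
  u v _ _ (_ , _ , inj₂ u≡1+v , _) c≡ → parity-suc (toℕ v) (trans (sym c≡) (cong parity u≡1+v))

Path-chiMixed₁ : ∀ {n j} → j ≤ n / 2 → ChiMixed≡ (Path n) 1 j (n ∸ 1 ∸ 2 * j)
Path-chiMixed₁ {n} {j} j≤n/2 =
  (survivingEdgeSet A , (A , ∣alternating∣ j n j≤n/2 , survivingEdgeSet-χ≤1 A)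
                      , length-survivingEdges-alternating j n j≤n/2)
  , minimal
  where
  A = alternating j n
  minimal : ∀ E → IsMixedRemovalSet (Path n) 1 j E → n ∸ 1 ∸ 2 * j ≤ card {G = Path n} E
  minimal E (V , ∣V∣≡j , χ≤1) = begin
    n ∸ 1 ∸ 2 * j              ≡⟨ cong (λ s → n ∸ 1 ∸ 2 * s) (sym ∣V∣≡j) ⟩
    n ∸ 1 ∸ 2 * ∣ V ∣          ≤⟨ length-survivingEdges-≥ V ⟩
    length (survivingEdges V)  ≤⟨ Unique⇒length-mono-⊆ (survivingEdges-unique V) (χ≤1⇒survivingEdges⊆ E χ≤1) ⟩
    card {G = Path n} E        ∎
    where open ≤-Reasoning

Path-chiMixed₂₊ : ∀ {n k j} → 2 ≤ k → j ≤ n / 2 → ChiMixed≡ (Path n) k j 0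
Path-chiMixed₂₊ {n} {j = j} (s≤s (s≤s _)) j≤n/2 =
  (∅ , (alternating j n , ∣alternating∣ j n j≤n/2 , Path-χ≤2+k _ ∅) , refl) , λ _ _ → z≤n
  where
  ∅ : EdgeSet (Path n)
  ∅ = [] , [] , []

mainTheorem8 : (n k j : ℕ) → 1 ≤ k → j ≤ n / 2 →
    (k ≡ 1 → ChiMixed≡ (Path n) k j (n ∸ 1 ∸ 2 * j))
    × (2 ≤ k → ChiMixed≡ (Path n) k j 0)
mainTheorem8 n k j _ j≤n/2 = (λ { refl → Path-chiMixed₁ j≤n/2 }) , λ 2≤k → Path-chiMixed₂₊ 2≤k j≤n/2
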